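{- Let $s\ge 2$, $n\ge1$ be integers, let $t_1,\ldots,t_s$ be non-negative integers and let $1\le r<s$. Then $$p\big(n,s,(t_1,\ldots,t_s)\big)\le p\big(n,s,(t_1,\ldots,t_r,0,\ldots,0)\big)\cdot p\big(n,s,(0,\ldots,0,t_{r+1},\ldots,t_s)\big).$$
   Context: $[s]=\{1,\ldots,s\}$ and $[s]^n$ is the set of all sequences $\vec y=(y_1,\ldots,y_n)$ with $y_j\in[s]$. For non-negative integers $t_1,\ldots,t_s$, a family $\mathcal{F}\subset[s]^n$ is called $(t_1,\ldots,t_s)$-intersecting if for all $\vec y,\vec z\in\mathcal{F}$ (not necessarily distinct) and every $\ell\in[s]$, the number of coordinates $j$ with $y_j=z_j=\ell$ is at least $t_\ell$. For $\vec t=(t_1,\ldots,t_s)$ define $p(n,s,\vec t)=\max\{|\mathcal{F}|/s^n:\ \mathcal{F}\subset[s]^n \text{ is } \vec t\text{ -intersecting}\}$. -}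

module Defs where

open import Data.Bool using (Bool; true; false; if_then_else_; _∧_)
open import Data.Nat using (ℕ; zero; suc; _+_; _^_; _≤ᵇ_; _<ᵇ_; _⊔_)
open import Data.Fin using (Fin; toℕ; _≟_)
open import Data.Vec using (Vec; []; _∷_)
open import Data.List using (List; []; _∷_; [_]; _++_; map; concatMap; allFin; length; foldr)
open import Data.Integer using (+_)
open import Data.Rational using (ℚ; _/_; 0ℚ)
open import Relation.Nullary.Decidable using (⌊_⌋)

-- Sequences in [s]^n are vectors of length n over Fin s
-- (the value ℓ ∈ [s] is represented by the element of Fin s with toℕ = ℓ - 1).
Seq : ℕ → ℕ → Set
Seq s n = Vec (Fin s) n

agree : ∀ {s n} → Fin s → Seq s n → Seq s n → ℕ
agree ℓ [] [] = 0
agree ℓ (a ∷ y) (b ∷ z) =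
  (if ⌊ a ≟ ℓ ⌋ ∧ ⌊ b ≟ ℓ ⌋ then 1 else 0) + agree ℓ y z

allᵇ : ∀ {A : Set} → (A → Bool) → List A → Bool
allᵇ P [] = true
allᵇ P (x ∷ xs) = P x ∧ allᵇ P xs

intersecting : ∀ {s n} → (Fin s → ℕ) → List (Seq s n) → Bool
intersecting {s} t F =
  allᵇ (λ y → allᵇ (λ z → allᵇ (λ ℓ → t ℓ ≤ᵇ agree ℓ y z) (allFin s)) F) F

allSeqs : (s n : ℕ) → List (Seq s n)
allSeqs s zero = [ [] ]
allSeqs s (suc n) = concatMap (λ a → map (a ∷_) (allSeqs s n)) (allFin s)

-- all sublists (= all subsets of a repetition-free list)
sublists : ∀ {A : Set} → List A → List (List A)
sublists [] = [ [] ]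
sublists (x ∷ xs) = sublists xs ++ map (x ∷_) (sublists xs)

maxFamily : (n s : ℕ) → (Fin s → ℕ) → ℕ
maxFamily n s t =
  foldr (λ F m → (if intersecting t F then length F else 0) ⊔ m) 0
        (sublists (allSeqs s n))

-- a / d as a rational (d = 0 never occurs in use since s ≥ 2)
frac : ℕ → ℕ → ℚ
frac a zero = 0ℚ
frac a (suc d) = (+ a) / suc d

p : (n s : ℕ) → (Fin s → ℕ) → ℚ
p n s t = frac (maxFamily n s t) (s ^ n)

-- (t_1,…,t_r,0,…,0) and (0,…,0,t_{r+1},…,t_s)  (ℓ ∈ Fin s is 0-based)
lowPart : ∀ {s} → ℕ → (Fin s → ℕ) → Fin s → ℕ
lowPart r t ℓ = if toℕ ℓ <ᵇ r then t ℓ else 0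

highPart : ∀ {s} → ℕ → (Fin s → ℕ) → Fin s → ℕ
highPart r t ℓ = if toℕ ℓ <ᵇ r then 0 else t ℓ

-- Split the colours into the selected ones S = {1,…,r} and the rest, and order [s]^n by
-- x ≼_S y iff y keeps every coordinate of x whose colour lies in S.  If F is t-intersecting,
-- its up-closure U₁ for ≼_S is (t_1,…,t_r,0,…,0)-intersecting, because for a colour in S the
-- agreements of two sequences can only grow when going up; likewise its up-closure U₂ for the
-- complementary order is (0,…,0,t_{r+1},…,t_s)-intersecting.  Both contain F, and U₁, U₂ are
-- negatively correlated: s^n |U₁ ∩ U₂| ≤ |U₁| |U₂|.  This is proved by induction on n, the
-- step being Chebyshev's sum inequality for the sizes of the sections at the first
-- coordinate, which are oppositely ordered.  Hence |F| s^n ≤ |U₁| |U₂|.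
module Submission where

open import Defs
open import Data.Nat using (ℕ; _≤_; _<_)
open import Data.Fin using (Fin)
open import Data.Rational using (_*_) renaming (_≤_ to _≤ℚ_)

open import Data.Bool using (Bool; true; false; if_then_else_; _∧_; not; T)
open import Data.Bool.ListAction using (any)
open import Data.Bool.Properties using (T-∧; T-≡)
open import Data.Empty using (⊥-elim)
open import Data.Fin using (toℕ; _≟_)
open import Data.Integer as ℤ using (+≤+)
import Data.Integer.Properties as ℤ
open import Data.List using (List; []; _∷_; _++_; map; concatMap; allFin; length; foldr; filterᵇ)
open import Data.List.Membership.Propositional using (_∈_; find; lose)
open import Data.List.Membership.Propositional.Properties
  using (∈-++⁻; ∈-++⁺ˡ; ∈-++⁺ʳ; ∈-map⁻; ∈-map⁺; ∈-allFin; ∈-filter⁻)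
open import Data.List.Properties using (length-tabulate; map-cong)
open import Data.List.Relation.Unary.Any using (here; there)
open import Data.List.Relation.Unary.Any.Properties using (any⁺; any⁻)
open import Data.Nat using (zero; suc; _+_; _^_; _⊔_; _<ᵇ_; z≤n; s≤s) renaming (_*_ to _*ₙ_)
open import Data.Nat.ListAction using (sum)
open import Data.Nat.Properties hiding (_≟_)
open import Data.Nat.Tactic.RingSolver using (solve-∀)
open import Data.Vec using ([]; _∷_)
open import Data.Product using (∃; _×_; _,_; proj₁; proj₂)
open import Data.Rational using (toℚᵘ)
import Data.Rational.Properties as ℚ
open import Data.Rational.Unnormalised using (mkℚᵘ; *≤*) renaming (_*_ to _*ᵘ_)
import Data.Rational.Unnormalised.Properties as ℚᵘ
open import Data.Sum using (inj₁; inj₂)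
open import Function using (_∘_; id)
open import Function.Bundles using (Equivalence)
open import Relation.Nullary.Decidable using (⌊_⌋; yes; no; toWitness; fromWitness; T?)
open import Relation.Binary.PropositionalEquality
  using (_≡_; refl; sym; trans; cong; cong₂; subst; subst₂)

allᵇ⁺ : ∀ {A : Set} (P : A → Bool) xs → (∀ {x} → x ∈ xs → T (P x)) → T (allᵇ P xs)
allᵇ⁺ P []       h = _
allᵇ⁺ P (x ∷ xs) h = Equivalence.from T-∧ (h (here refl) , allᵇ⁺ P xs (h ∘ there))

allᵇ⁻ : ∀ {A : Set} (P : A → Bool) xs → T (allᵇ P xs) → ∀ {x} → x ∈ xs → T (P x)
allᵇ⁻ P (y ∷ xs) h (here refl) = proj₁ (Equivalence.to T-∧ h)
allᵇ⁻ P (y ∷ xs) h (there x∈)  = allᵇ⁻ P xs (proj₂ (Equivalence.to T-∧ h)) x∈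

module _ {s n : ℕ} (t : Fin s → ℕ) (F : List (Seq s n)) where

  intersecting⁺ : (∀ {x y} → x ∈ F → y ∈ F → ∀ ℓ → t ℓ ≤ agree ℓ x y) → T (intersecting t F)
  intersecting⁺ h =
    allᵇ⁺ _ F λ x∈ → allᵇ⁺ _ F λ y∈ → allᵇ⁺ _ (allFin s) λ {ℓ} _ → ≤⇒≤ᵇ (h x∈ y∈ ℓ)

  intersecting⁻ : T (intersecting t F) → ∀ {x y} → x ∈ F → y ∈ F → ∀ ℓ → t ℓ ≤ agree ℓ x y
  intersecting⁻ h x∈ y∈ ℓ =
    ≤ᵇ⇒≤ (t ℓ) _ (allᵇ⁻ _ (allFin s) (allᵇ⁻ _ F (allᵇ⁻ _ F h x∈) y∈) (∈-allFin ℓ))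

count : ∀ {A : Set} → (A → Bool) → List A → ℕ
count P []       = 0
count P (x ∷ xs) = (if P x then 1 else 0) + count P xs

count-mono : ∀ {A : Set} {P Q : A → Bool} → (∀ {x} → T (P x) → T (Q x)) →
             ∀ xs → count P xs ≤ count Q xs
count-mono P⇒Q [] = z≤n
count-mono {P = P} {Q} P⇒Q (x ∷ xs) with P x in Px | Q x in Qx
... | true  | true  = s≤s (count-mono P⇒Q xs)
... | true  | false = ⊥-elim (subst T Qx (P⇒Q (Equivalence.from T-≡ Px)))
... | false | _     = ≤-trans (count-mono P⇒Q xs) (m≤n+m _ _)

count-++ : ∀ {A : Set} (P : A → Bool) xs ys → count P (xs ++ ys) ≡ count P xs + count P ys
count-++ P []       ys = refl
count-++ P (x ∷ xs) ys =
  trans (cong (_ +_) (count-++ P xs ys)) (sym (+-assoc (if P x then 1 else 0) _ _))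

count-map : ∀ {A B : Set} (P : B → Bool) (f : A → B) xs → count P (map f xs) ≡ count (P ∘ f) xs
count-map P f []       = refl
count-map P f (x ∷ xs) = cong (_ +_) (count-map P f xs)

count-concatMap : ∀ {A B : Set} (P : B → Bool) (f : A → List B) xs →
                  count P (concatMap f xs) ≡ sum (map (count P ∘ f) xs)
count-concatMap P f []       = refl
count-concatMap P f (x ∷ xs) =
  trans (count-++ P (f x) (concatMap f xs)) (cong (_ +_) (count-concatMap P f xs))

length-filterᵇ : ∀ {A : Set} (P : A → Bool) xs → length (filterᵇ P xs) ≡ count P xs
length-filterᵇ P []       = refl
length-filterᵇ P (x ∷ xs) with P x
... | true  = cong suc (length-filterᵇ P xs)
... | false = length-filterᵇ P xs

filterᵇ∈sublists : ∀ {A : Set} (P : A → Bool) xs → filterᵇ P xs ∈ sublists xs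
filterᵇ∈sublists P []       = here refl
filterᵇ∈sublists P (x ∷ xs) with P x
... | true  = ∈-++⁺ʳ (sublists xs) (∈-map⁺ (x ∷_) (filterᵇ∈sublists P xs))
... | false = ∈-++⁺ˡ (filterᵇ∈sublists P xs)

length≤count : ∀ {A : Set} {P : A → Bool} xs {F} → F ∈ sublists xs →
               (∀ {x} → x ∈ F → T (P x)) → length F ≤ count P xs
length≤count []       (here refl) _ = z≤n
length≤count {P = P} (x ∷ xs) F∈ F⊆P with ∈-++⁻ (sublists xs) F∈
... | inj₁ F∈′ = ≤-trans (length≤count xs F∈′ F⊆P) (m≤n+m _ _)
... | inj₂ F∈′ with ∈-map⁻ (x ∷_) F∈′
...   | G , G∈ , refl with P x in Px
...     | true  = s≤s (length≤count xs G∈ (F⊆P ∘ there))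
...     | false = ⊥-elim (subst T Px (F⊆P (here refl)))

∑ : ∀ {A : Set} → List A → (A → ℕ) → ℕ
∑ xs f = sum (map f xs)

syntax ∑ xs (λ a → e) = ∑[ a ∈ xs ] e

module _ {A : Set} where

  ∑-cong : ∀ {f g : A → ℕ} → (∀ a → f a ≡ g a) → ∀ xs → ∑ xs f ≡ ∑ xs g
  ∑-cong f≗g xs = cong sum (map-cong f≗g xs)

  ∑-mono : ∀ {f g : A → ℕ} → (∀ a → f a ≤ g a) → ∀ xs → ∑ xs f ≤ ∑ xs g
  ∑-mono f≤g []       = z≤n
  ∑-mono f≤g (x ∷ xs) = +-mono-≤ (f≤g x) (∑-mono f≤g xs)

  ∑-+ : ∀ (f g : A → ℕ) xs → ∑[ a ∈ xs ] (f a + g a) ≡ ∑ xs f + ∑ xs g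
  ∑-+ f g []       = refl
  ∑-+ f g (x ∷ xs) = trans (cong (f x + g x +_) (∑-+ f g xs)) (+-+-swap (f x) _ _ _)
    where
    +-+-swap : ∀ a b c d → (a + b) + (c + d) ≡ (a + c) + (b + d)
    +-+-swap = solve-∀

  ∑-*ˡ : ∀ c (f : A → ℕ) xs → ∑[ a ∈ xs ] (c *ₙ f a) ≡ c *ₙ ∑ xs f
  ∑-*ˡ c f []       = sym (*-zeroʳ c)
  ∑-*ˡ c f (x ∷ xs) = trans (cong (c *ₙ f x +_) (∑-*ˡ c f xs)) (sym (*-distribˡ-+ c (f x) _))

  ∑-*ʳ : ∀ c (f : A → ℕ) xs → ∑[ a ∈ xs ] (f a *ₙ c) ≡ ∑ xs f *ₙ c
  ∑-*ʳ c f xs = trans (∑-cong (λ a → *-comm (f a) c) xs) (trans (∑-*ˡ c f xs) (*-comm c _))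

  ∑-const : ∀ c (xs : List A) → ∑[ _ ∈ xs ] c ≡ length xs *ₙ c
  ∑-const c []       = refl
  ∑-const c (x ∷ xs) = cong (c +_) (∑-const c xs)

-- (x a − x b) (y a − y b) ≤ 0, with the terms moved so that no subtraction occurs.
OppositelyOrdered : ∀ {A : Set} → (A → ℕ) → (A → ℕ) → Set
OppositelyOrdered x y = ∀ a b → x a *ₙ y a + x b *ₙ y b ≤ x a *ₙ y b + x b *ₙ y a

rearrangement : ∀ {xa xb ya yb} → xb ≤ xa → ya ≤ yb → xa *ₙ ya + xb *ₙ yb ≤ xa *ₙ yb + xb *ₙ ya
rearrangement {xb = xb} {ya} xb≤xa ya≤yb with m≤n⇒∃[o]m+o≡n xb≤xa | m≤n⇒∃[o]m+o≡n ya≤yb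
... | d , refl | e , refl =
  subst ((xb + d) *ₙ ya + xb *ₙ (ya + e) ≤_) (identity xb d ya e) (m≤m+n _ (d *ₙ e))
  where
  identity : ∀ p d u e → ((p + d) *ₙ u + p *ₙ (u + e)) + d *ₙ e ≡ (p + d) *ₙ (u + e) + p *ₙ u
  identity = solve-∀

rearrangement′ : ∀ {xa xb ya yb} → xa ≤ xb → yb ≤ ya → xa *ₙ ya + xb *ₙ yb ≤ xa *ₙ yb + xb *ₙ ya
rearrangement′ {xa} {xb} {ya} {yb} xa≤xb yb≤ya =
  subst₂ _≤_ (+-comm (xb *ₙ yb) (xa *ₙ ya)) (+-comm (xb *ₙ ya) (xa *ₙ yb)) (rearrangement xa≤xb yb≤ya)

oppositelyOrdered-split : ∀ {A : Set} (σ : A → Bool) (x y : A → ℕ) →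
  (∀ {a} b → σ a ≡ false → x a ≤ x b) → (∀ {a} b → σ a ≡ true → y a ≤ y b) →
  OppositelyOrdered x y
oppositelyOrdered-split σ x y x-least y-least a b with σ a in σa | σ b in σb
... | true  | false = rearrangement  (x-least a σb) (y-least b σa)
... | false | true  = rearrangement′ (x-least b σa) (y-least a σb)
... | false | false with ≤-total (y a) (y b)
...   | inj₁ ya≤yb = rearrangement  (x-least a σb) ya≤yb
...   | inj₂ yb≤ya = rearrangement′ (x-least b σa) yb≤ya
oppositelyOrdered-split σ x y x-least y-least a b | true | true with ≤-total (x a) (x b)
...   | inj₁ xa≤xb = rearrangement′ xa≤xb (y-least a σb)
...   | inj₂ xb≤xa = rearrangement  xb≤xa (y-least b σa)

chebyshev : ∀ {A : Set} (I : List A) (x y : A → ℕ) → OppositelyOrdered x y →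
            length I *ₙ ∑[ a ∈ I ] (x a *ₙ y a) ≤ ∑ I x *ₙ ∑ I y
chebyshev I x y opposite = *-cancelˡ-≤ 2 (begin
  2 *ₙ (length I *ₙ Sxy)                               ≡⟨ diagonal ⟨
  ∑[ a ∈ I ] ∑[ b ∈ I ] (x a *ₙ y a + x b *ₙ y b)      ≤⟨ ∑-mono (λ a → ∑-mono (opposite a) I) I ⟩
  ∑[ a ∈ I ] ∑[ b ∈ I ] (x a *ₙ y b + x b *ₙ y a)      ≡⟨ crossed ⟩
  2 *ₙ (∑ I x *ₙ ∑ I y)                                ∎)
  where
  open ≤-Reasoning
  Sxy : ℕ
  Sxy = ∑[ a ∈ I ] (x a *ₙ y a)

  twice : ∀ m → m + m ≡ 2 *ₙ m
  twice m = cong (m +_) (sym (+-identityʳ m))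

  diagonal : ∑[ a ∈ I ] ∑[ b ∈ I ] (x a *ₙ y a + x b *ₙ y b) ≡ 2 *ₙ (length I *ₙ Sxy)
  diagonal = begin-equality
    ∑[ a ∈ I ] ∑[ b ∈ I ] (x a *ₙ y a + x b *ₙ y b)
      ≡⟨ ∑-cong (λ a → trans (∑-+ _ _ I) (cong (_+ Sxy) (∑-const (x a *ₙ y a) I))) I ⟩
    ∑[ a ∈ I ] (length I *ₙ (x a *ₙ y a) + Sxy)
      ≡⟨ ∑-+ _ _ I ⟩
    ∑[ a ∈ I ] (length I *ₙ (x a *ₙ y a)) + ∑[ _ ∈ I ] Sxy
      ≡⟨ cong₂ _+_ (∑-*ˡ (length I) _ I) (∑-const Sxy I) ⟩
    length I *ₙ Sxy + length I *ₙ Sxy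
      ≡⟨ twice (length I *ₙ Sxy) ⟩
    2 *ₙ (length I *ₙ Sxy) ∎

  crossed : ∑[ a ∈ I ] ∑[ b ∈ I ] (x a *ₙ y b + x b *ₙ y a) ≡ 2 *ₙ (∑ I x *ₙ ∑ I y)
  crossed = begin-equality
    ∑[ a ∈ I ] ∑[ b ∈ I ] (x a *ₙ y b + x b *ₙ y a)
      ≡⟨ ∑-cong (λ a → trans (∑-+ _ _ I) (cong₂ _+_ (∑-*ˡ (x a) y I) (∑-*ʳ (y a) x I))) I ⟩
    ∑[ a ∈ I ] (x a *ₙ ∑ I y + ∑ I x *ₙ y a)
      ≡⟨ ∑-+ _ _ I ⟩
    ∑[ a ∈ I ] (x a *ₙ ∑ I y) + ∑[ a ∈ I ] (∑ I x *ₙ y a)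
      ≡⟨ cong₂ _+_ (∑-*ʳ (∑ I y) x I) (∑-*ˡ (∑ I x) y I) ⟩
    ∑ I x *ₙ ∑ I y + ∑ I x *ₙ ∑ I y
      ≡⟨ twice (∑ I x *ₙ ∑ I y) ⟩
    2 *ₙ (∑ I x *ₙ ∑ I y) ∎

≤-foldr-⊔ : ∀ {A : Set} (f : A → ℕ) {a as} → a ∈ as → f a ≤ foldr (λ b m → f b ⊔ m) 0 as
≤-foldr-⊔ f (here refl) = m≤m⊔n _ _
≤-foldr-⊔ f (there a∈)  = ≤-trans (≤-foldr-⊔ f a∈) (m≤n⊔m _ _)

foldr-⊔-*-≤ : ∀ {A : Set} (f : A → ℕ) as N K → (∀ {a} → a ∈ as → f a *ₙ N ≤ K) →
              foldr (λ b m → f b ⊔ m) 0 as *ₙ N ≤ K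
foldr-⊔-*-≤ f []       N K bound = z≤n
foldr-⊔-*-≤ f (a ∷ as) N K bound =
  subst (_≤ K) (sym (*-distribʳ-⊔ N (f a) _))
        (⊔-lub (bound (here refl)) (foldr-⊔-*-≤ f as N K (bound ∘ there)))

module _ {s : ℕ} (n : ℕ) (t : Fin s → ℕ) where

  maxFamily-≥ : ∀ {F} → F ∈ sublists (allSeqs s n) → T (intersecting t F) → length F ≤ maxFamily n s t
  maxFamily-≥ {F} F∈ F-int = ≤-trans (scored F-int) (≤-foldr-⊔ _ F∈)
    where
    scored : T (intersecting t F) → length F ≤ (if intersecting t F then length F else 0)
    scored _ with intersecting t F
    ... | true = ≤-refl

  maxFamily-*-≤ : ∀ N K →
    (∀ {F} → F ∈ sublists (allSeqs s n) → T (intersecting t F) → length F *ₙ N ≤ K) →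
    maxFamily n s t *ₙ N ≤ K
  maxFamily-*-≤ N K bound = foldr-⊔-*-≤ _ _ N K scored
    where
    scored : ∀ {F} → F ∈ sublists (allSeqs s n) → (if intersecting t F then length F else 0) *ₙ N ≤ K
    scored {F} F∈ with intersecting t F in F-int
    ... | true  = bound F∈ (Equivalence.from T-≡ F-int)
    ... | false = z≤n

restrict : ∀ {s} → (Fin s → Bool) → (Fin s → ℕ) → Fin s → ℕ
restrict σ t ℓ = if σ ℓ then t ℓ else 0

module _ {s : ℕ} where

  infix 7 _⊑[_]_ _≼[_]_

  _⊑[_]_ : Fin s → (Fin s → Bool) → Fin s → Bool
  a ⊑[ σ ] b = if σ a then ⌊ a ≟ b ⌋ else true

  _≼[_]_ : ∀ {n} → Seq s n → (Fin s → Bool) → Seq s n → Bool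
  []      ≼[ σ ] []      = true
  (a ∷ x) ≼[ σ ] (b ∷ y) = a ⊑[ σ ] b ∧ x ≼[ σ ] y

  module _ {σ : Fin s → Bool} where

    ⊑-refl : ∀ a → T (a ⊑[ σ ] a)
    ⊑-refl a with σ a
    ... | true  = fromWitness refl
    ... | false = _

    ⊑-selected : ∀ a b → σ a ≡ true → T (a ⊑[ σ ] b) → a ≡ b
    ⊑-selected a b σa a⊑b rewrite σa = toWitness a⊑b

    ⊑-unselected : ∀ a b → σ a ≡ false → T (a ⊑[ σ ] b)
    ⊑-unselected a b σa rewrite σa = _

    ⊑-trans : ∀ a b c → T (a ⊑[ σ ] b) → T (b ⊑[ σ ] c) → T (a ⊑[ σ ] c)
    ⊑-trans a b c a⊑b b⊑c with σ a in σa
    ... | false = _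
    ... | true with refl ← toWitness a⊑b = subst (λ v → T (if v then ⌊ a ≟ c ⌋ else true)) σa b⊑c

    ≼-∷⁺ : ∀ {n} a b (x y : Seq s n) → T (a ⊑[ σ ] b) → T (x ≼[ σ ] y) → T ((a ∷ x) ≼[ σ ] (b ∷ y))
    ≼-∷⁺ a b x y a⊑b x≼y = Equivalence.from T-∧ (a⊑b , x≼y)

    ≼-∷⁻ : ∀ {n} a b (x y : Seq s n) → T ((a ∷ x) ≼[ σ ] (b ∷ y)) → T (a ⊑[ σ ] b) × T (x ≼[ σ ] y)
    ≼-∷⁻ a b x y = Equivalence.to (T-∧ {a ⊑[ σ ] b})

    ≼-refl : ∀ {n} (x : Seq s n) → T (x ≼[ σ ] x)
    ≼-refl []      = _
    ≼-refl (a ∷ x) = ≼-∷⁺ a a x x (⊑-refl a) (≼-refl x)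

    ≼-trans : ∀ {n} (x y z : Seq s n) → T (x ≼[ σ ] y) → T (y ≼[ σ ] z) → T (x ≼[ σ ] z)
    ≼-trans []      []      []      _     _     = _
    ≼-trans (a ∷ x) (b ∷ y) (c ∷ z) ax≼by by≼cz =
      let a⊑b , x≼y = ≼-∷⁻ a b x y ax≼by; b⊑c , y≼z = ≼-∷⁻ b c y z by≼cz
      in  ≼-∷⁺ a c x z (⊑-trans a b c a⊑b b⊑c) (≼-trans x y z x≼y y≼z)

    coincidence-mono : ∀ ℓ a b c d → σ ℓ ≡ true → T (a ⊑[ σ ] c) → T (b ⊑[ σ ] d) →
      (if ⌊ a ≟ ℓ ⌋ ∧ ⌊ b ≟ ℓ ⌋ then 1 else 0) ≤ (if ⌊ c ≟ ℓ ⌋ ∧ ⌊ d ≟ ℓ ⌋ then 1 else 0)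
    coincidence-mono ℓ a b c d σℓ a⊑c b⊑d with a ≟ ℓ | b ≟ ℓ
    ... | no _     | _        = z≤n
    ... | yes _    | no _     = z≤n
    ... | yes refl | yes refl
      with refl ← ⊑-selected a c σℓ a⊑c | refl ← ⊑-selected a d σℓ b⊑d | a ≟ a
    ...   | yes _  = ≤-refl
    ...   | no a≢a = ⊥-elim (a≢a refl)

    agree-mono : ∀ {n} ℓ (x x′ y y′ : Seq s n) → σ ℓ ≡ true →
                 T (x ≼[ σ ] y) → T (x′ ≼[ σ ] y′) → agree ℓ x x′ ≤ agree ℓ y y′
    agree-mono ℓ []      []       []      []       _  _     _       = z≤n
    agree-mono ℓ (a ∷ x) (b ∷ x′) (c ∷ y) (d ∷ y′) σℓ ax≼cy bx′≼dy′ =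
      let a⊑c , x≼y = ≼-∷⁻ a c x y ax≼cy; b⊑d , x′≼y′ = ≼-∷⁻ b d x′ y′ bx′≼dy′
      in  +-mono-≤ (coincidence-mono ℓ a b c d σℓ a⊑c b⊑d) (agree-mono ℓ x x′ y y′ σℓ x≼y x′≼y′)

  upset : ∀ {n} → (Fin s → Bool) → List (Seq s n) → Seq s n → Bool
  upset σ F y = any (λ x → x ≼[ σ ] y) F

  Increasing : ∀ {n} → (Fin s → Bool) → (Seq s n → Bool) → Set
  Increasing σ P = ∀ x y → T (x ≼[ σ ] y) → T (P x) → T (P y)

  module _ {n : ℕ} (σ : Fin s → Bool) (F : List (Seq s n)) where

    ∈⇒upset : ∀ {x} → x ∈ F → T (upset σ F x)
    ∈⇒upset {x} x∈ = any⁺ _ (lose x∈ (≼-refl x))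

    upset-increasing : Increasing σ (upset σ F)
    upset-increasing x y x≼y x∈↑ with find (any⁻ _ F x∈↑)
    ... | w , w∈ , w≼x = any⁺ _ (lose w∈ (≼-trans w x y w≼x x≼y))

    upset-intersecting : ∀ {t t′ : Fin s → ℕ} ys → (∀ ℓ → t′ ℓ ≤ restrict σ t ℓ) →
                         T (intersecting t F) → T (intersecting t′ (filterᵇ (upset σ F) ys))
    upset-intersecting {t} {t′} ys t′≤ F-int = intersecting⁺ t′ _ bound
      where
      below : ∀ {y} → y ∈ filterᵇ (upset σ F) ys → ∃ λ x → x ∈ F × T (x ≼[ σ ] y)
      below y∈ = find (any⁻ _ F (proj₂ (∈-filter⁻ (T? ∘ upset σ F) {xs = ys} y∈)))

      bound : ∀ {y z} → y ∈ filterᵇ (upset σ F) ys → z ∈ filterᵇ (upset σ F) ys →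
              ∀ ℓ → t′ ℓ ≤ agree ℓ y z
      bound {y} {z} y∈ z∈ ℓ with below y∈ | below z∈ | σ ℓ in σℓ | t′≤ ℓ
      ... | x , x∈ , x≼y | x′ , x′∈ , x′≼z | true  | t′ℓ≤tℓ =
        ≤-trans t′ℓ≤tℓ (≤-trans (intersecting⁻ t F F-int x∈ x′∈ ℓ)
                                (agree-mono ℓ x x′ y z σℓ x≼y x′≼z))
      ... | _ | _ | false | t′ℓ≤0 = ≤-trans t′ℓ≤0 z≤n

  module _ {n} (σ : Fin s → Bool) {P : Seq s (suc n) → Bool} (P↑ : Increasing σ P) where

    section-increasing : ∀ a → Increasing σ (λ y → P (a ∷ y))
    section-increasing a x y x≼y = P↑ (a ∷ x) (a ∷ y) (≼-∷⁺ a a x y (⊑-refl {σ = σ} a) x≼y)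

    increasing-head : ∀ {a} b y → σ a ≡ false → T (P (a ∷ y)) → T (P (b ∷ y))
    increasing-head {a} b y σa =
      P↑ (a ∷ y) (b ∷ y) (≼-∷⁺ a b y y (⊑-unselected {σ = σ} a b σa) (≼-refl y))

  count-allSeqs : ∀ n (P : Seq s (suc n) → Bool) →
    count P (allSeqs s (suc n)) ≡ ∑[ a ∈ allFin s ] count (λ y → P (a ∷ y)) (allSeqs s n)
  count-allSeqs n P =
    trans (count-concatMap P _ (allFin s))
          (∑-cong (λ a → count-map P (a ∷_) (allSeqs s n)) (allFin s))

  -- The sections of A (of B) at the first coordinate are smallest at unselected (selected)
  -- colours, so their sizes are oppositely ordered and Chebyshev's inequality applies.
  harris-kleitman : ∀ n (σ : Fin s → Bool) {A B : Seq s n → Bool} →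
    Increasing σ A → Increasing (not ∘ σ) B →
    s ^ n *ₙ count (λ y → A y ∧ B y) (allSeqs s n) ≤ count A (allSeqs s n) *ₙ count B (allSeqs s n)
  harris-kleitman zero σ {A} {B} _ _ with A [] | B []
  ... | true  | true  = ≤-refl
  ... | true  | false = z≤n
  ... | false | _     = z≤n
  harris-kleitman (suc n) σ {A} {B} A↑ B↑ = begin
    s ^ suc n *ₙ count (λ y → A y ∧ B y) (allSeqs s (suc n))
      ≡⟨ cong (s ^ suc n *ₙ_) (count-allSeqs n (λ y → A y ∧ B y)) ⟩
    s *ₙ s ^ n *ₙ ∑ I z
      ≡⟨ trans (*-assoc s (s ^ n) _) (cong (s *ₙ_) (sym (∑-*ˡ (s ^ n) z I))) ⟩
    s *ₙ ∑[ a ∈ I ] (s ^ n *ₙ z a)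
      ≤⟨ *-monoʳ-≤ s (∑-mono on-sections I) ⟩
    s *ₙ ∑[ a ∈ I ] (x a *ₙ y a)
      ≡⟨ cong (_*ₙ ∑[ a ∈ I ] (x a *ₙ y a)) (length-tabulate {n = s} id) ⟨
    length I *ₙ ∑[ a ∈ I ] (x a *ₙ y a)
      ≤⟨ chebyshev I x y (oppositelyOrdered-split σ x y x-least y-least) ⟩
    ∑ I x *ₙ ∑ I y
      ≡⟨ cong₂ _*ₙ_ (count-allSeqs n A) (count-allSeqs n B) ⟨
    count A (allSeqs s (suc n)) *ₙ count B (allSeqs s (suc n)) ∎
    where
    open ≤-Reasoning
    I : List (Fin s)
    I = allFin s
    x y z : Fin s → ℕ
    x a = count (λ v → A (a ∷ v)) (allSeqs s n)
    y a = count (λ v → B (a ∷ v)) (allSeqs s n)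
    z a = count (λ v → A (a ∷ v) ∧ B (a ∷ v)) (allSeqs s n)

    on-sections : ∀ a → s ^ n *ₙ z a ≤ x a *ₙ y a
    on-sections a =
      harris-kleitman n σ (section-increasing σ A↑ a) (section-increasing (not ∘ σ) B↑ a)

    x-least : ∀ {a} b → σ a ≡ false → x a ≤ x b
    x-least b σa = count-mono (increasing-head σ A↑ b _ σa) (allSeqs s n)

    y-least : ∀ {a} b → σ a ≡ true → y a ≤ y b
    y-least b σa = count-mono (increasing-head (not ∘ σ) B↑ b _ (cong not σa)) (allSeqs s n)

maxFamily-split : ∀ n s (σ : Fin s → Bool) {t t₁ t₂ : Fin s → ℕ} →
  (∀ ℓ → t₁ ℓ ≤ restrict σ t ℓ) → (∀ ℓ → t₂ ℓ ≤ restrict (not ∘ σ) t ℓ) →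
  maxFamily n s t *ₙ s ^ n ≤ maxFamily n s t₁ *ₙ maxFamily n s t₂
maxFamily-split n s σ {t} {t₁} {t₂} t₁≤ t₂≤ = maxFamily-*-≤ n t (s ^ n) _ bound
  where
  open ≤-Reasoning
  Ω : List (Seq s n)
  Ω = allSeqs s n

  count-upset≤maxFamily : ∀ σ′ F {t′} → (∀ ℓ → t′ ℓ ≤ restrict σ′ t ℓ) → T (intersecting t F) →
                          count (upset σ′ F) Ω ≤ maxFamily n s t′
  count-upset≤maxFamily σ′ F {t′} t′≤ F-int = subst (_≤ maxFamily n s t′) (length-filterᵇ _ Ω)
    (maxFamily-≥ n t′ (filterᵇ∈sublists _ Ω) (upset-intersecting σ′ F Ω t′≤ F-int))

  bound : ∀ {F} → F ∈ sublists Ω → T (intersecting t F) →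
          length F *ₙ s ^ n ≤ maxFamily n s t₁ *ₙ maxFamily n s t₂
  bound {F} F∈ F-int = begin
    length F *ₙ s ^ n                     ≤⟨ *-monoˡ-≤ (s ^ n) (length≤count Ω F∈ F⊆U₁∩U₂) ⟩
    count (λ y → U₁ y ∧ U₂ y) Ω *ₙ s ^ n  ≡⟨ *-comm _ (s ^ n) ⟩
    s ^ n *ₙ count (λ y → U₁ y ∧ U₂ y) Ω  ≤⟨ harris-kleitman n σ (upset-increasing σ F)
                                                                 (upset-increasing (not ∘ σ) F) ⟩
    count U₁ Ω *ₙ count U₂ Ω              ≤⟨ *-mono-≤ (count-upset≤maxFamily σ F t₁≤ F-int)
                                                      (count-upset≤maxFamily (not ∘ σ) F t₂≤ F-int) ⟩
    maxFamily n s t₁ *ₙ maxFamily n s t₂  ∎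
    where
    U₁ U₂ : Seq s n → Bool
    U₁ = upset σ F
    U₂ = upset (not ∘ σ) F

    F⊆U₁∩U₂ : ∀ {x} → x ∈ F → T (U₁ x ∧ U₂ x)
    F⊆U₁∩U₂ x∈ = Equivalence.from T-∧ (∈⇒upset σ F x∈ , ∈⇒upset (not ∘ σ) F x∈)

frac-≤-frac-* : ∀ M a b N → M *ₙ N ≤ a *ₙ b → frac M N ≤ℚ frac a N * frac b N
frac-≤-frac-* M a b zero    _     = ℚ.≤-refl
-- For N = suc d, frac m N is by definition fromℚᵘ (mkℚᵘ (+ m) d).
frac-≤-frac-* M a b (suc d) MN≤ab = ℚ.toℚᵘ-cancel-≤ (begin
  toℚᵘ (frac M N)
    ≃⟨ ℚ.toℚᵘ-fromℚᵘ (mkℚᵘ (ℤ.+ M) d) ⟩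
  mkℚᵘ (ℤ.+ M) d
    ≤⟨ *≤* cross ⟩
  mkℚᵘ (ℤ.+ a) d *ᵘ mkℚᵘ (ℤ.+ b) d
    ≃⟨ ℚᵘ.*-cong (ℚ.toℚᵘ-fromℚᵘ (mkℚᵘ (ℤ.+ a) d)) (ℚ.toℚᵘ-fromℚᵘ (mkℚᵘ (ℤ.+ b) d)) ⟨
  toℚᵘ (frac a N) *ᵘ toℚᵘ (frac b N)
    ≃⟨ ℚ.toℚᵘ-homo-* (frac a N) (frac b N) ⟨
  toℚᵘ (frac a N * frac b N) ∎)
  where
  open ℚᵘ.≤-Reasoning
  N : ℕ
  N = suc d
  cross : ℤ.+ M ℤ.* ℤ.+ (N *ₙ N) ℤ.≤ (ℤ.+ a ℤ.* ℤ.+ b) ℤ.* ℤ.+ N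
  cross = subst₂ ℤ._≤_ (ℤ.pos-* M (N *ₙ N))
                       (trans (ℤ.pos-* (a *ₙ b) N) (cong (ℤ._* ℤ.+ N) (ℤ.pos-* a b)))
            (+≤+ (subst (_≤ a *ₙ b *ₙ N) (*-assoc M N N) (*-monoˡ-≤ N {M *ₙ N} {a *ₙ b} MN≤ab)))

lemma1 : (s n : ℕ) → 2 ≤ s → 1 ≤ n → (t : Fin s → ℕ) → (r : ℕ) → 1 ≤ r → r < s →
    p n s t ≤ℚ (p n s (lowPart r t) * p n s (highPart r t))
lemma1 s n _ _ t r _ _ =
  frac-≤-frac-* _ _ _ (s ^ n) (maxFamily-split n s σ (λ _ → ≤-refl) highPart≤)
  where
  σ : Fin s → Bool
  σ ℓ = toℕ ℓ <ᵇ r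

  highPart≤ : ∀ ℓ → highPart r t ℓ ≤ restrict (not ∘ σ) t ℓ
  highPart≤ ℓ with σ ℓ
  ... | true  = z≤n
  ... | false = ≤-refl
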